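{- Let $\mathcal{P}$ be a profile of unrooted phylogenetic trees whose display graph $G(\mathcal{P})$ is connected. A set $F$ is a legal minimal separator of the edge label intersection graph $L(\mathcal{P})$ if and only if $F$ is a legal minimal cut of $G(\mathcal{P})$.
   Context: A phylogenetic tree is an unrooted tree whose leaves are bijectively labeled; a profile $\mathcal{P}$ is a finite collection of phylogenetic trees. The display graph $G(\mathcal{P})$ is the union of the trees of $\mathcal{P}$ (vertex set $\bigcup V(T)$, edge set $\bigcup E(T)$), where leaves with the same label in different trees are identified and all other vertices of different trees are distinct. The edge label intersection graph $L(\mathcal{P})$ is the line graph of $G(\mathcal{P})$: its vertices are the edges of the input trees, two adjacent iff they share an endpoint; $L(T)$ denotes the line graph of an input tree $T$. A minimal separator of a graph is a vertex set $U$ that, for some nonadjacent vertices $a,b$, separates $a$ from $b$ and has no proper subset separating $a$ from $b$. A minimal separator $F$ of $L(\mathcal{P})$ is legal if for every $F'\subseteq F$ with $F'\subseteq V(L(T))$ for some input tree $T$, $F'$ is a clique in $L(T)$. In a connected graph, a cut is a set of edges whose removal disconnects the graph; it is minimal if no proper subset is a cut. A cut $F$ of $G(\mathcal{P})$ is legal if (LC1) for every tree $T\in\mathcal{P}$ the edges of $T$ in $F$ are incident on a common vertex, and (LC2) each connected component of $G(\mathcal{P})-F$ contains at least one edge. -}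

module Defs where

open import Data.Nat using (ℕ; _≤_)
open import Data.Fin using (Fin)
open import Data.Bool using (Bool; true; false)
open import Data.Sum using (_⊎_; inj₁; inj₂)
open import Data.Product using (Σ; ∃; _×_; _,_; proj₁; proj₂)
open import Data.List using (List; []; _∷_; _∷ʳ_; length)
open import Data.List.Relation.Unary.Unique.Propositional using (Unique)
open import Data.List.Relation.Unary.Linked using (Linked)
open import Relation.Binary.PropositionalEquality using (_≡_; _≢_)
open import Relation.Nullary using (¬_)
open import Function.Bundles using (_⇔_)

BSet : Set → Set
BSet A = A → Bool

_∈ᵇ_ : {A : Set} → A → BSet A → Set
a ∈ᵇ S = S a ≡ true

_∉ᵇ_ : {A : Set} → A → BSet A → Set
a ∉ᵇ S = S a ≡ false

_⊆ᵇ_ : {A : Set} → BSet A → BSet A → Set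
S ⊆ᵇ T = ∀ a → a ∈ᵇ S → a ∈ᵇ T

-- A vertex  inj₁ x  is the leaf labelled x (shared by all trees having
-- label x -- this realises the identification in the display graph),
-- and  inj₂ (j , v)  is the v-th internal (non-leaf) vertex of tree j
-- (private to tree j).

record RawProfile : Set where
  field
    m    : ℕ                      -- number of labels, X = Fin m
    k    : ℕ                      -- number of trees
    nI   : Fin k → ℕ              -- number of internal vertices of tree i
    lab  : Fin k → BSet (Fin m)
    ne   : Fin k → ℕ
    ends : (i : Fin k) → Fin (ne i) →
           (Fin m ⊎ Σ (Fin k) (λ j → Fin (nI j))) ×
           (Fin m ⊎ Σ (Fin k) (λ j → Fin (nI j)))

module _ (P : RawProfile) where
  open RawProfile P

  Vtx : Set
  Vtx = Fin m ⊎ Σ (Fin k) (λ j → Fin (nI j))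

  -- edges of G(P) = vertices of L(P): disjoint union of the edge sets
  Edge : Set
  Edge = Σ (Fin k) (λ i → Fin (ne i))

  tree : Edge → Fin k
  tree = proj₁

  endsE : Edge → Vtx × Vtx
  endsE (i , e) = ends i e

  Inc : Edge → Vtx → Set
  Inc e v = proj₁ (endsE e) ≡ v ⊎ proj₂ (endsE e) ≡ v

  Joins : Edge → Vtx → Vtx → Set
  Joins e u w = (proj₁ (endsE e) ≡ u × proj₂ (endsE e) ≡ w)
              ⊎ (proj₁ (endsE e) ≡ w × proj₂ (endsE e) ≡ u)

  InT : Fin k → Vtx → Set
  InT i (inj₁ x)       = x ∈ᵇ lab i
  InT i (inj₂ (j , v)) = j ≡ i

  AdjT : Fin k → Vtx → Vtx → Set
  AdjT i u w = Σ (Fin (ne i)) (λ e → Joins (i , e) u w)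

  data ReachT (i : Fin k) (u : Vtx) : Vtx → Set where
    here : ReachT i u u
    step : ∀ {w w'} → ReachT i u w → AdjT i w w' → ReachT i u w'

  HasCycle : Fin k → Set
  HasCycle i = Σ Vtx λ x → Σ (List Vtx) λ xs →
                 Unique (x ∷ xs) × 2 ≤ length xs ×
                 Linked (AdjT i) ((x ∷ xs) ∷ʳ x)

  -- leaf of T_i: a vertex of degree at most one (degree 1, or the single
  -- vertex of a one-vertex tree)
  IsLeafT : Fin k → Vtx → Set
  IsLeafT i v = ∀ (e e' : Fin (ne i)) → Inc (i , e) v → Inc (i , e') v → e ≡ e'

  record IsPhyloTree (i : Fin k) : Set where
    field
      endsIn₁   : ∀ e → InT i (proj₁ (ends i e))
      endsIn₂   : ∀ e → InT i (proj₂ (ends i e))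
      noLoop    : ∀ e → proj₁ (ends i e) ≢ proj₂ (ends i e)
      noParallel : ∀ e e' u w → Joins (i , e) u w → Joins (i , e') u w → e ≡ e'
      nonempty  : Σ Vtx (InT i)
      connected : ∀ u w → InT i u → InT i w → ReachT i u w
      acyclic   : ¬ HasCycle i
      leavesLabelled : ∀ x → InT i (inj₁ x) → IsLeafT i (inj₁ x)
      internalNotLeaf : ∀ (v : Fin (nI i)) → ¬ IsLeafT i (inj₂ (i , v))

  IsProfile : Set
  IsProfile = ∀ i → IsPhyloTree i

  InG : Vtx → Set
  InG v = Σ (Fin k) (λ i → InT i v)

  data ReachG (F : BSet Edge) (u : Vtx) : Vtx → Set where
    here : ReachG F u u
    step : ∀ {w w'} → ReachG F u w → (e : Edge) → e ∉ᵇ F →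
           Joins e w w' → ReachG F u w'

  ConnectedG : Set
  ConnectedG = ∀ u w → InG u → InG w → ReachG (λ _ → false) u w

  IsCut : BSet Edge → Set
  IsCut F = Σ Vtx λ u → Σ Vtx λ w → InG u × InG w × ¬ ReachG F u w

  IsMinimalCut : BSet Edge → Set
  IsMinimalCut F = IsCut F × (∀ F' → F' ⊆ᵇ F → IsCut F' → F ⊆ᵇ F')

  LC1 : BSet Edge → Set
  LC1 F = ∀ (i : Fin k) → Σ Vtx λ v →
            ∀ (e : Fin (ne i)) → (i , e) ∈ᵇ F → Inc (i , e) v

  LC2 : BSet Edge → Set
  LC2 F = ∀ v → InG v → Σ Edge λ e → e ∉ᵇ F ×
            Σ Vtx λ u → Inc e u × ReachG F v u

  IsLegalMinimalCut : BSet Edge → Set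
  IsLegalMinimalCut F = IsMinimalCut F × LC1 F × LC2 F

  -- Edge label intersection graph L(P) = line graph of G(P)

  AdjL : Edge → Edge → Set
  AdjL e e' = e ≢ e' × Σ Vtx (λ v → Inc e v × Inc e' v)

  data ReachL (U : BSet Edge) (a : Edge) : Edge → Set where
    here : ReachL U a a
    step : ∀ {b c} → ReachL U a b → AdjL b c → c ∉ᵇ U → ReachL U a c

  Separates : BSet Edge → Edge → Edge → Set
  Separates U a b = a ∉ᵇ U × b ∉ᵇ U × ¬ ReachL U a b

  IsMinimalSeparator : BSet Edge → Set
  IsMinimalSeparator U = Σ Edge λ a → Σ Edge λ b →
    a ≢ b × ¬ AdjL a b × Separates U a b ×
    (∀ U' → U' ⊆ᵇ U → Separates U' a b → U ⊆ᵇ U')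

  InLT : Fin k → BSet Edge → Set
  InLT i F' = ∀ e → e ∈ᵇ F' → tree e ≡ i

  AdjLT : Fin k → Edge → Edge → Set
  AdjLT i e e' = tree e ≡ i × tree e' ≡ i × AdjL e e'

  IsCliqueLT : Fin k → BSet Edge → Set
  IsCliqueLT i F' = ∀ e e' → e ∈ᵇ F' → e' ∈ᵇ F' → e ≢ e' → AdjLT i e e'

  IsLegalMinimalSeparator : BSet Edge → Set
  IsLegalMinimalSeparator F = IsMinimalSeparator F ×
    (∀ F' → F' ⊆ᵇ F → ∀ i → InLT i F' → IsCliqueLT i F')

-- Removing an edge f from a minimal separator F of L(P) reconnects its two sides a and b,
-- and a reconnecting walk must pass through f; so f joins a vertex of the component of a
-- to a vertex of the component of b in G(P) − F. Edges with this "bridge" property can be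
-- crossed at no cost, so no proper subset of F cuts G(P), and every vertex sits next to an
-- edge outside F. Conversely, the components of G(P) − F around the edges given by (LC2)
-- are separated in L(P), and minimality transfers the same way. Legality amounts to (LC1)
-- because three pairwise adjacent edges of a tree without a common vertex form a triangle.
module Submission where

open import Defs
open import Function.Bundles using (_⇔_; mk⇔)
open import Function.Base using (_∘_; case_of_)
open import Data.Nat using (s≤s; z≤n)
open import Data.Fin using (Fin)
import Data.Fin.Properties as Fin
open import Data.Bool using (true; false)
import Data.Bool as Bool
import Data.Bool.Properties as Bool
open import Data.Sum using (_⊎_; inj₁; inj₂)
import Data.Sum.Properties as Sum
open import Data.Product using (Σ; _×_; _,_; proj₁; proj₂)
import Data.Product.Properties as Product
open import Data.List using ([]; _∷_)
open import Data.List.Relation.Unary.All using ([]; _∷_)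
open import Data.List.Relation.Unary.AllPairs using ([]; _∷_)
open import Data.List.Relation.Unary.Linked using ([-]; _∷_)
open import Data.Empty using (⊥-elim)
open import Effect.Monad using (RawMonad)
open import Level using (0ℓ)
open import Relation.Nullary using (¬_; Dec; yes; no)
open import Relation.Nullary.Negation using (¬¬-Monad; ¬¬-map; contradiction)
open import Relation.Nullary.Decidable using (decidable-stable; _×-dec_; ¬?)
open import Relation.Binary.PropositionalEquality
  using (_≡_; _≢_; refl; sym; trans; ≢-sym)
open import Axiom.UniquenessOfIdentityProofs using (module Decidable⇒UIP)

open RawMonad (¬¬-Monad {a = 0ℓ}) using (pure; _>>=_)

module _ {A : Set} where

  ⊆ᵇ-∉ᵇ : {S T : BSet A} → S ⊆ᵇ T → ∀ {a} → a ∉ᵇ T → a ∉ᵇ S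
  ⊆ᵇ-∉ᵇ {S} S⊆T {a} a∉T with S a in eq
  ... | true  = ⊥-elim (Bool.not-¬ (S⊆T a eq) a∉T)
  ... | false = refl

module _ (P : RawProfile) where
  open RawProfile P

  private
    V : Set
    V = Vtx P
    E : Set
    E = Edge P

  _≟V_ : (u w : V) → Dec (u ≡ w)
  _≟V_ = Sum.≡-dec Fin._≟_ (Product.≡-dec Fin._≟_ Fin._≟_)

  _≟E_ : (e f : E) → Dec (e ≡ f)
  _≟E_ = Product.≡-dec Fin._≟_ Fin._≟_

  ∅ : BSet E
  ∅ _ = false

  _∖_ : BSet E → E → BSet E
  (F ∖ f) e with e ≟E f
  ... | yes _ = false
  ... | no  _ = F e

  ∖-⊆ᵇ : ∀ F f → (F ∖ f) ⊆ᵇ F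
  ∖-⊆ᵇ F f e e∈ with e ≟E f
  ... | no _ = e∈

  ∉-∖ : ∀ F f → f ∉ᵇ (F ∖ f)
  ∉-∖ F f with f ≟E f
  ... | yes _ = refl
  ... | no f≢f = contradiction refl f≢f

  ∉⇒∉-∖ : ∀ F f e → e ∉ᵇ F → e ∉ᵇ (F ∖ f)
  ∉⇒∉-∖ F f e e∉F with e ≟E f
  ... | yes _ = refl
  ... | no  _ = e∉F

  ∉-∖⇒≡⊎∉ : ∀ {F f e} → e ∉ᵇ (F ∖ f) → e ≡ f ⊎ e ∉ᵇ F
  ∉-∖⇒≡⊎∉ {f = f} {e} e∉ with e ≟E f
  ... | yes e≡f = inj₁ e≡f
  ... | no  _   = inj₂ e∉

  ⊆ᵇ-∖ : ∀ {U F f} → U ⊆ᵇ F → f ∉ᵇ U → U ⊆ᵇ (F ∖ f)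
  ⊆ᵇ-∖ {f = f} U⊆F f∉U e e∈U with e ≟E f
  ... | yes refl = ⊥-elim (Bool.not-¬ e∈U f∉U)
  ... | no  _    = U⊆F e e∈U

  minimal⇒¬∖ : ∀ {Q : BSet E → Set} {F f} →
               (∀ U → U ⊆ᵇ F → Q U → F ⊆ᵇ U) → f ∈ᵇ F → ¬ Q (F ∖ f)
  minimal⇒¬∖ {F = F} {f} minimal f∈F Q[F∖f] =
    Bool.not-¬ (minimal (F ∖ f) (∖-⊆ᵇ F f) Q[F∖f] f f∈F) (∉-∖ F f)

  Inc? : (e : E) (v : V) → Dec (Inc P e v)
  Inc? e v with proj₁ (endsE P e) ≟V v | proj₂ (endsE P e) ≟V v
  ... | yes p | _     = yes (inj₁ p)
  ... | no _  | yes q = yes (inj₂ q)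
  ... | no p  | no q  = no λ { (inj₁ x) → p x ; (inj₂ x) → q x }

  anyEdge? : (Q : E → Set) → (∀ e → Dec (Q e)) → Dec (Σ E Q)
  anyEdge? Q Q? with Fin.any? (λ i → Fin.any? (λ e → Q? (i , e)))
  ... | yes (i , e , q) = yes ((i , e) , q)
  ... | no none         = no λ { ((i , e) , q) → none (i , e , q) }

  joins-sym : ∀ {e u w} → Joins P e u w → Joins P e w u
  joins-sym (inj₁ p) = inj₂ p
  joins-sym (inj₂ p) = inj₁ p

  joins⇒inc₁ : ∀ {e u w} → Joins P e u w → Inc P e u
  joins⇒inc₁ (inj₁ (p , _)) = inj₁ p
  joins⇒inc₁ (inj₂ (_ , q)) = inj₂ q

  joins⇒inc₂ : ∀ {e u w} → Joins P e u w → Inc P e w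
  joins⇒inc₂ = joins⇒inc₁ ∘ joins-sym

  inc⇒joins : ∀ {e u w} → Inc P e u → Inc P e w → u ≢ w → Joins P e u w
  inc⇒joins (inj₁ p) (inj₁ q) u≢w = contradiction (trans (sym p) q) u≢w
  inc⇒joins (inj₁ p) (inj₂ q) _   = inj₁ (p , q)
  inc⇒joins (inj₂ p) (inj₁ q) _   = inj₂ (q , p)
  inc⇒joins (inj₂ p) (inj₂ q) u≢w = contradiction (trans (sym p) q) u≢w

  joins-inc : ∀ {e u w z} → Joins P e u w → Inc P e z → z ≡ u ⊎ z ≡ w
  joins-inc (inj₁ (p , q)) (inj₁ r) = inj₁ (trans (sym r) p)
  joins-inc (inj₁ (p , q)) (inj₂ r) = inj₂ (trans (sym r) q)
  joins-inc (inj₂ (p , q)) (inj₁ r) = inj₂ (trans (sym r) p)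
  joins-inc (inj₂ (p , q)) (inj₂ r) = inj₁ (trans (sym r) q)

  reachG-trans : ∀ {F u v w} → ReachG P F u v → ReachG P F v w → ReachG P F u w
  reachG-trans p here              = p
  reachG-trans p (step q e e∉F j) = step (reachG-trans p q) e e∉F j

  reachG-sym : ∀ {F u w} → ReachG P F u w → ReachG P F w u
  reachG-sym here              = here
  reachG-sym (step p e e∉F j) = reachG-trans (step here e e∉F (joins-sym j)) (reachG-sym p)

  reachG-mono : ∀ {F F' u w} → F' ⊆ᵇ F → ReachG P F u w → ReachG P F' u w
  reachG-mono F'⊆F here              = here
  reachG-mono F'⊆F (step p e e∉F j) = step (reachG-mono F'⊆F p) e (⊆ᵇ-∉ᵇ F'⊆F e∉F) j

  reachG-edge : ∀ {F e u w} → e ∉ᵇ F → Inc P e u → Inc P e w → ReachG P F u w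
  reachG-edge {u = u} {w} e∉F eu ew with u ≟V w
  ... | yes refl = here
  ... | no u≢w   = step here _ e∉F (inc⇒joins eu ew u≢w)

  reachG-incident : ∀ {F c u w} → c ∉ᵇ F → Inc P c u → ReachG P F u w →
                    Σ E λ h → h ∉ᵇ F × Inc P h w
  reachG-incident c∉F cu here              = _ , c∉F , cu
  reachG-incident c∉F cu (step _ e e∉F j) = e , e∉F , joins⇒inc₂ j

  reachL-trans : ∀ {F a b c} → ReachL P F a b → ReachL P F b c → ReachL P F a c
  reachL-trans p here            = p
  reachL-trans p (step q adj c∉) = step (reachL-trans p q) adj c∉

  adjL-sym : ∀ {e f} → AdjL P e f → AdjL P f e
  adjL-sym (e≢f , v , ev , fv) = ≢-sym e≢f , v , fv , ev

  reachL-∉ : ∀ {F a c} → a ∉ᵇ F → ReachL P F a c → c ∉ᵇ F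
  reachL-∉ a∉F here           = a∉F
  reachL-∉ a∉F (step _ _ c∉F) = c∉F

  reachL-sym : ∀ {F a c} → a ∉ᵇ F → ReachL P F a c → ReachL P F c a
  reachL-sym a∉F here             = here
  reachL-sym a∉F (step r adj c∉F) =
    reachL-trans (step here (adjL-sym adj) (reachL-∉ a∉F r)) (reachL-sym a∉F r)

  reachL-mono : ∀ {F F' a c} → F' ⊆ᵇ F → ReachL P F a c → ReachL P F' a c
  reachL-mono F'⊆F here             = here
  reachL-mono F'⊆F (step p adj c∉F) = step (reachL-mono F'⊆F p) adj (⊆ᵇ-∉ᵇ F'⊆F c∉F)

  reachL-extend : ∀ {F a b c z} → ReachL P F a c → Inc P c z → Inc P b z → b ∉ᵇ F →
                  ReachL P F a b
  reachL-extend {b = b} {c} r cz bz b∉F with c ≟E b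
  ... | yes refl = r
  ... | no c≢b   = step r (c≢b , _ , cz , bz) b∉F

  reachG⇒reachL : ∀ {F a b x z} → a ∉ᵇ F → Inc P a x → b ∉ᵇ F → Inc P b z →
                  ReachG P F x z → ReachL P F a b
  reachG⇒reachL a∉F ax b∉F bz here = reachL-extend here ax bz b∉F
  reachG⇒reachL a∉F ax b∉F bz (step p e e∉F j) =
    reachL-extend (reachG⇒reachL a∉F ax e∉F (joins⇒inc₁ j) p) (joins⇒inc₂ j) bz b∉F

  reachL⇒reachG : ∀ {F a c x z} → a ∉ᵇ F → Inc P a x → Inc P c z →
                  ReachL P F a c → ReachG P F x z
  reachL⇒reachG a∉F ax cz here = reachG-edge a∉F ax cz
  reachL⇒reachG a∉F ax cz (step r (_ , v , bv , cv) c∉F) =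
    reachG-trans (reachL⇒reachG a∉F ax bv r) (reachG-edge c∉F cv cz)

  reachL-∖ : ∀ {F f a c} → ReachL P (F ∖ f) a c →
             ReachL P F a c ⊎ Σ E (λ p → ReachL P F a p × AdjL P p f)
  reachL-∖ here = inj₁ here
  reachL-∖ (step r adj c∉) with reachL-∖ r
  ... | inj₂ near = inj₂ near
  reachL-∖ {F} {f} (step {c = c} r adj c∉) | inj₁ r' with ∉-∖⇒≡⊎∉ {F} {f} {c} c∉
  ... | inj₁ refl = inj₂ (_ , r' , adj)
  ... | inj₂ c∉F  = inj₁ (step r' adj c∉F)

  record Bridge (F : BSet E) (x y : V) (f : E) : Set where
    field
      {left right} : V
      joins : Joins P f left right
      fromX : ReachG P F x left
      fromY : ReachG P F y right

  -- A walk from a to b avoiding F ∖ f but not F must use f, entering it from a's side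
  -- and leaving it towards b's side through different endpoints.
  reconnect⇒bridge : ∀ {F f a b x y} → a ∉ᵇ F → b ∉ᵇ F → Inc P a x → Inc P b y →
                     ¬ ReachL P F a b → ReachL P (F ∖ f) a b → Bridge F x y f
  reconnect⇒bridge {F} {f} {a} a∉F b∉F ax by ¬ab r
    with reachL-∖ r | reachL-∖ (reachL-sym (∉⇒∉-∖ F f a a∉F) r)
  ... | inj₁ ab | _ = contradiction ab ¬ab
  ... | inj₂ _ | inj₁ ba = contradiction (reachL-sym b∉F ba) ¬ab
  ... | inj₂ (p , ap , _ , u , pu , fu) | inj₂ (q , bq , _ , w , qw , fw) with u ≟V w
  ...   | yes refl =
          contradiction (reachL-trans (reachL-extend ap pu qw (reachL-∉ b∉F bq))
                                      (reachL-sym b∉F bq)) ¬ab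
  ...   | no u≢w = record
          { joins = inc⇒joins fu fw u≢w
          ; fromX = reachL⇒reachG a∉F ax pu ap
          ; fromY = reachL⇒reachG b∉F by qw bq
          }

  minimalSeparator⇒bridge :
    ∀ {F a b x y} → a ∉ᵇ F → b ∉ᵇ F → Inc P a x → Inc P b y → ¬ ReachL P F a b →
    (∀ U → U ⊆ᵇ F → Separates P U a b → F ⊆ᵇ U) →
    ∀ {f} → f ∈ᵇ F → ¬ ¬ Bridge F x y f
  minimalSeparator⇒bridge {F} {a} {b} a∉F b∉F ax by ¬ab minimal {f} f∈F =
    ¬¬-map (reconnect⇒bridge a∉F b∉F ax by ¬ab)
      (λ ¬r → minimal⇒¬∖ minimal f∈F (∉⇒∉-∖ F f a a∉F , ∉⇒∉-∖ F f b b∉F , ¬r))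

  module _ {F F' : BSet E} {x y : V}
           (bridges : ∀ {f} → f ∈ᵇ F → ¬ ¬ Bridge F x y f)
           (F'⊆F : F' ⊆ᵇ F) (xy : ReachG P F' x y) where

    -- Once x and y are joined in G(P) − F', every edge of F' leads back to one of them.
    bridged-reach : ∀ {z} → ReachG P ∅ x z → ¬ ¬ ReachG P F' x z
    bridged-reach here = pure here
    bridged-reach (step {w} {z} p e _ j) = bridged-reach p >>= cross
      where
      cross : ReachG P F' x w → ¬ ¬ ReachG P F' x z
      cross xw with F' e in e∈F'?
      ... | false = pure (step xw e e∈F'? j)
      ... | true  = do
        b ← bridges (F'⊆F e e∈F'?)
        let open Bridge b
        pure (case joins-inc joins (joins⇒inc₂ j) of λ where
          (inj₁ refl) → reachG-mono F'⊆F fromX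
          (inj₂ refl) → reachG-trans xy (reachG-mono F'⊆F fromY))

  _↾_ : BSet E → Fin k → BSet E
  (F ↾ i) (j , e) with j Fin.≟ i
  ... | yes _ = F (j , e)
  ... | no  _ = false

  ↾-⊆ᵇ : ∀ F i → (F ↾ i) ⊆ᵇ F
  ↾-⊆ᵇ F i (j , e) e∈ with j Fin.≟ i
  ... | yes _ = e∈

  ↾-InLT : ∀ F i → InLT P i (F ↾ i)
  ↾-InLT F i (j , e) e∈ with j Fin.≟ i
  ... | yes j≡i = j≡i

  ∈⇒∈-↾ : ∀ F {i} e → (i , e) ∈ᵇ F → (i , e) ∈ᵇ (F ↾ i)
  ∈⇒∈-↾ F {i} e e∈ with i Fin.≟ i
  ... | yes _   = e∈
  ... | no  i≢i = contradiction refl i≢i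

  edge-injective : ∀ {i} {e e' : Fin (ne i)} → _≡_ {A = E} (i , e) (i , e') → e ≡ e'
  edge-injective = Product.,-injectiveʳ-UIP (Decidable⇒UIP.≡-irrelevant Fin._≟_)

  LC1⇒legal : ∀ F → LC1 P F → ∀ F' → F' ⊆ᵇ F → ∀ i → InLT P i F' → IsCliqueLT P i F'
  LC1⇒legal F lc1 F' F'⊆F i F'∈Tᵢ (j , e) (j' , e') e∈ e'∈ e≢e'
    with F'∈Tᵢ (j , e) e∈ | F'∈Tᵢ (j' , e') e'∈
  ... | refl | refl =
    let v , Fᵢ-at-v = lc1 i
    in refl , refl , e≢e' , v , Fᵢ-at-v e (F'⊆F _ e∈) , Fᵢ-at-v e' (F'⊆F _ e'∈)

  module _ {i : Fin k} (Tᵢ : IsPhyloTree P i) where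
    open IsPhyloTree Tᵢ

    triangle-free : ∀ {e e₀ e₁ v} → e₀ ≢ e₁ → Inc P (i , e₀) v → Inc P (i , e₁) v →
                    AdjL P (i , e) (i , e₀) → AdjL P (i , e) (i , e₁) → Inc P (i , e) v
    triangle-free {e} {e₀} {e₁} {v} e₀≢e₁ e₀v e₁v (_ , x , ex , e₀x) (_ , y , ey , e₁y) =
      decidable-stable (Inc? (i , e) v) (acyclic ∘ triangle)
      where
      triangle : ¬ Inc P (i , e) v → HasCycle P i
      triangle ¬ev =
        v , x ∷ y ∷ [] ,
        (v≢x ∷ v≢y ∷ []) ∷ (x≢y ∷ []) ∷ [] ∷ [] ,
        s≤s (s≤s z≤n) ,
        (e₀ , inc⇒joins e₀v e₀x v≢x) ∷ (e , inc⇒joins ex ey x≢y) ∷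
        (e₁ , inc⇒joins e₁y e₁v (≢-sym v≢y)) ∷ [-]
        where
        v≢x : v ≢ x
        v≢x refl = ¬ev ex
        v≢y : v ≢ y
        v≢y refl = ¬ev ey
        x≢y : x ≢ y
        x≢y refl = e₀≢e₁ (noParallel e₀ e₁ v x (inc⇒joins e₀v e₀x v≢x) (inc⇒joins e₁v e₁y v≢x))

    clique⇒commonVertex :
      (F : BSet E) → (∀ e e' → (i , e) ∈ᵇ F → (i , e') ∈ᵇ F → e ≢ e' → AdjL P (i , e) (i , e')) →
      Σ V λ v → ∀ e → (i , e) ∈ᵇ F → Inc P (i , e) v
    clique⇒commonVertex F adjacent with Fin.any? (λ e → F (i , e) Bool.≟ true)
    ... | no none = proj₁ nonempty , λ e e∈ → contradiction (e , e∈) none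
    ... | yes (e₀ , e₀∈)
        with Fin.any? (λ e → (F (i , e) Bool.≟ true) ×-dec ¬? (e Fin.≟ e₀))
    ...   | no none = proj₁ (ends i e₀) , at-e₀
      where
      at-e₀ : ∀ e → (i , e) ∈ᵇ F → Inc P (i , e) (proj₁ (ends i e₀))
      at-e₀ e e∈ with e Fin.≟ e₀
      ... | yes refl = inj₁ refl
      ... | no e≢e₀  = contradiction (e , e∈ , e≢e₀) none
    ...   | yes (e₁ , e₁∈ , e₁≢e₀) with adjacent e₀ e₁ e₀∈ e₁∈ (≢-sym e₁≢e₀)
    ...     | _ , v , e₀v , e₁v = v , at-v
      where
      at-v : ∀ e → (i , e) ∈ᵇ F → Inc P (i , e) v
      at-v e e∈ with e Fin.≟ e₀ | e Fin.≟ e₁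
      ... | yes refl | _        = e₀v
      ... | no _     | yes refl = e₁v
      ... | no e≢e₀  | no e≢e₁  =
        triangle-free (≢-sym e₁≢e₀) e₀v e₁v
          (adjacent e e₀ e∈ e₀∈ e≢e₀) (adjacent e e₁ e∈ e₁∈ e≢e₁)

  module WithProfile (prof : IsProfile P) where

    endpoint∈G : ∀ {e v} → Inc P e v → InG P v
    endpoint∈G {i , e} (inj₁ refl) = i , IsPhyloTree.endsIn₁ (prof i) e
    endpoint∈G {i , e} (inj₂ refl) = i , IsPhyloTree.endsIn₂ (prof i) e

    module _ (conn : ConnectedG P) {F : BSet E} {a b : E}
             (a∉F : a ∉ᵇ F) (b∉F : b ∉ᵇ F) (¬ab : ¬ ReachL P F a b)
             (minimal : ∀ U → U ⊆ᵇ F → Separates P U a b → F ⊆ᵇ U) where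

      private
        x y : V
        x = proj₁ (endsE P a)
        y = proj₁ (endsE P b)

        bridge : ∀ {f} → f ∈ᵇ F → ¬ ¬ Bridge F x y f
        bridge = minimalSeparator⇒bridge a∉F b∉F (inj₁ refl) (inj₁ refl) ¬ab minimal

        reach-from-x : ∀ {F'} → F' ⊆ᵇ F → ReachG P F' x y → ∀ {z} → InG P z → ¬ ¬ ReachG P F' x z
        reach-from-x F'⊆F xy z∈G =
          bridged-reach bridge F'⊆F xy (conn x _ (endpoint∈G (inj₁ refl)) z∈G)

        bridge-reconnects : ∀ {F' f} → F' ⊆ᵇ F → f ∈ᵇ F → f ∉ᵇ F' → ¬ ¬ ReachG P F' x y
        bridge-reconnects {f = f} F'⊆F f∈F f∉F' = do
          b ← bridge f∈F
          let open Bridge b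
          pure (reachG-trans (step (reachG-mono F'⊆F fromX) f f∉F' joins)
                             (reachG-sym (reachG-mono F'⊆F fromY)))

        ¬cut : ∀ {F' f} → F' ⊆ᵇ F → f ∈ᵇ F → f ∉ᵇ F' → ¬ IsCut P F'
        ¬cut {F'} F'⊆F f∈F f∉F' (u , w , u∈G , w∈G , ¬uw) = uw ¬uw
          where
          uw : ¬ ¬ ReachG P F' u w
          uw = do
            xy ← bridge-reconnects F'⊆F f∈F f∉F'
            xu ← reach-from-x F'⊆F xy u∈G
            xw ← reach-from-x F'⊆F xy w∈G
            pure (reachG-trans (reachG-sym xu) xw)

      separator⇒minimalCut : IsMinimalCut P F
      separator⇒minimalCut =
        (x , y , endpoint∈G (inj₁ refl) , endpoint∈G (inj₁ refl) ,
         ¬ab ∘ reachG⇒reachL a∉F (inj₁ refl) b∉F (inj₁ refl)) ,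
        λ F' F'⊆F cut f f∈F →
          decidable-stable (F' f Bool.≟ true) λ f∉F' → ¬cut F'⊆F f∈F (Bool.¬-not f∉F') cut

      separator⇒LC2 : LC2 P F
      separator⇒LC2 v v∈G = let h , h∉F , hv = incident in h , h∉F , v , hv , here
        where
        outsideAt : ∀ {e} → Inc P e v → ¬ ¬ Σ E λ h → h ∉ᵇ F × Inc P h v
        outsideAt {e} ev with F e in e∈F?
        ... | false = pure (e , e∈F? , ev)
        ... | true  = do
          b ← bridge e∈F?
          let open Bridge b
          pure (case joins-inc joins ev of λ where
            (inj₁ refl) → reachG-incident a∉F (inj₁ refl) fromX
            (inj₂ refl) → reachG-incident b∉F (inj₁ refl) fromY)

        incident : Σ E λ h → h ∉ᵇ F × Inc P h v
        incident =
          let _ , _ , ev = reachG-incident {c = a} refl (inj₁ refl)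
                             (conn x v (endpoint∈G (inj₁ refl)) v∈G)
          in decidable-stable (anyEdge? _ (λ h → (F h Bool.≟ false) ×-dec Inc? h v)) (outsideAt ev)

    legal⇒LC1 : ∀ F → (∀ F' → F' ⊆ᵇ F → ∀ i → InLT P i F' → IsCliqueLT P i F') → LC1 P F
    legal⇒LC1 F legal i = clique⇒commonVertex (prof i) F adjacent
      where
      adjacent : ∀ e e' → (i , e) ∈ᵇ F → (i , e') ∈ᵇ F → e ≢ e' → AdjL P (i , e) (i , e')
      adjacent e e' e∈ e'∈ e≢e' =
        proj₂ (proj₂ (legal (F ↾ i) (↾-⊆ᵇ F i) i (↾-InLT F i) (i , e) (i , e')
                            (∈⇒∈-↾ F e e∈) (∈⇒∈-↾ F e' e'∈) (e≢e' ∘ edge-injective)))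

    minimalCut⇒minimalSeparator : ∀ {F} → IsMinimalCut P F → LC2 P F → IsMinimalSeparator P F
    minimalCut⇒minimalSeparator {F} ((u , w , u∈G , w∈G , ¬uw) , minimal) lc2
      with lc2 u u∈G | lc2 w w∈G
    ... | a , a∉F , x , ax , ux | b , b∉F , y , by , wy =
      a , b , (λ { refl → ¬ab here }) , (λ adj → ¬ab (step here adj b∉F)) ,
      (a∉F , b∉F , ¬ab) , minimalSeparator
      where
      ¬ab : ¬ ReachL P F a b
      ¬ab ab = ¬uw (reachG-trans ux (reachG-trans (reachL⇒reachG a∉F ax by ab) (reachG-sym wy)))

      minimalSeparator : ∀ U → U ⊆ᵇ F → Separates P U a b → F ⊆ᵇ U
      minimalSeparator U U⊆F (_ , _ , ¬abU) f f∈F =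
        decidable-stable (U f Bool.≟ true) λ f∉U →
          minimal⇒¬∖ minimal f∈F
            (x , y , endpoint∈G ax , endpoint∈G by , λ xy →
              ¬abU (reachL-mono (⊆ᵇ-∖ U⊆F (Bool.¬-not f∉U))
                     (reachG⇒reachL (∉⇒∉-∖ F f a a∉F) ax (∉⇒∉-∖ F f b b∉F) by xy)))

theorem5 : (P : RawProfile) → IsProfile P → ConnectedG P →
           (F : BSet (Edge P)) →
           IsLegalMinimalSeparator P F ⇔ IsLegalMinimalCut P F
theorem5 P prof conn F = mk⇔
  (λ ((a , b , _ , _ , (a∉F , b∉F , ¬ab) , minimal) , legal) →
     separator⇒minimalCut conn a∉F b∉F ¬ab minimal ,
     legal⇒LC1 F legal ,
     separator⇒LC2 conn a∉F b∉F ¬ab minimal)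
  (λ (cut , lc1 , lc2) → minimalCut⇒minimalSeparator cut lc2 , LC1⇒legal P F lc1)
  where open WithProfile P prof
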